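{- Let $\lambda$ be a partition and let $x_1,\ldots,x_{\ell(\lambda)},y_1,\ldots,y_{\lambda_1}$ be commuting variables. Then \[ \prod_{(i,j) \in [\lambda]} \left(x_{i} + \cdots + x_{\lambda_j'} + y_{j}+ \cdots + y_{\lambda_i}\right) = \sum_{(r,s) \in \mathcal{C}'[\lambda]} \Bigg[\prod_{\substack{(i,j) \in [\lambda]\\ i \neq r,\ j \neq s }} \left(x_{i} + \cdots + x_{\lambda_j'} + y_{j}+ \cdots + y_{\lambda_i}\right)\Bigg] \cdot \left[ \prod_{i=1}^{r-1} \left(x_{i+1} + \cdots + x_{r-1} + y_{s}+ \cdots + y_{\lambda_i}\right)\right] \cdot \left[ \prod_{j=1}^{s-1} \left(x_{r}+ \cdots + x_{\lambda_j'} + y_{j+1} + \cdots + y_{s-1}\right)\right]. \]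
   Context: For a partition $\lambda=(\lambda_1\ge\lambda_2\ge\cdots\ge\lambda_\ell>0)$, $\ell(\lambda)=\ell$ is its number of parts, its Young diagram is $[\lambda]=\{(i,j)\in\mathbb{Z}^2: 1\le i\le \ell,\ 1\le j\le\lambda_i\}$ (row index $i$, column index $j$), and the conjugate partition is $\lambda'_j=\max\{i:\lambda_i\ge j\}$. The set $\mathcal{C}'[\lambda]$ of outer corners of $\lambda$ consists of the squares $(i,j)\notin[\lambda]$ with $i,j\ge 1$ such that ($i=1$ or $(i-1,j)\in[\lambda]$) and ($j=1$ or $(i,j-1)\in[\lambda]$). A sum of the form $x_a+\cdots+x_b$ (or $y_a+\cdots+y_b$) with $b<a$ is $0$; an empty product is $1$. -}

module Defs where

open import Data.Nat using (ℕ; zero; suc; _+_; _∸_; _≤_; _≥_; _≤ᵇ_; _≡ᵇ_)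
open import Data.Bool using (Bool; true; false; _∧_; _∨_; not)
open import Data.List using (List; []; _∷_; map; concatMap; upTo; length; filterᵇ; foldr)
open import Data.List.Relation.Unary.All using (All)
open import Data.List.Relation.Unary.Linked using (Linked)
open import Data.Product using (_×_; _,_; proj₁; proj₂)
open import Algebra.Bundles using (CommutativeRing)

IsPartition : List ℕ → Set
IsPartition lam = All (λ k → 1 ≤ k) lam × Linked _≥_ lam

-- 0-indexed lookup with default 0
at : List ℕ → ℕ → ℕ
at []      _       = 0
at (a ∷ l) zero    = a
at (a ∷ l) (suc i) = at l i

-- λ_i (1-indexed; 0 for i = 0 or i > ℓ(λ))
part : List ℕ → ℕ → ℕ
part l zero    = 0
part l (suc i) = at l i

-- conjugate λ'_j = number of parts ≥ j  (= max{i : λ_i ≥ j} for a partition)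
conj : List ℕ → ℕ → ℕ
conj l j = length (filterᵇ (λ k → j ≤ᵇ k) l)

-- the list [a, a+1, ..., b]  (empty if b < a)
range : ℕ → ℕ → List ℕ
range a b = map (a +_) (upTo (suc b ∸ a))

cells : List ℕ → List (ℕ × ℕ)
cells l = concatMap (λ i → map (i ,_) (range 1 (part l i))) (range 1 (length l))

inDiagram : List ℕ → ℕ → ℕ → Bool
inDiagram l i j = (1 ≤ᵇ i) ∧ (1 ≤ᵇ j) ∧ (i ≤ᵇ length l) ∧ (j ≤ᵇ part l i)

-- outer-corner test, exactly as in the definition of C'[λ] (for i, j ≥ 1)
isOuterCorner : List ℕ → ℕ → ℕ → Bool
isOuterCorner l i j =
  not (inDiagram l i j)
  ∧ ((i ≡ᵇ 1) ∨ inDiagram l (i ∸ 1) j)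
  ∧ ((j ≡ᵇ 1) ∨ inDiagram l i (j ∸ 1))

-- C'[λ] as a list: every outer corner (r,s) has 1 ≤ r ≤ ℓ+1 and 1 ≤ s ≤ λ_1+1,
-- so we filter that finite box.
outerCorners : List ℕ → List (ℕ × ℕ)
outerCorners l =
  filterᵇ (λ c → isOuterCorner l (proj₁ c) (proj₂ c))
    (concatMap (λ i → map (i ,_) (range 1 (suc (part l 1)))) (range 1 (suc (length l))))

module _ {c ℓ} (R : CommutativeRing c ℓ) where
  open CommutativeRing R using (Carrier; 0#; 1#; _≈_) renaming (_+_ to _⊕_; _*_ to _⊗_)

  -- Σ_{k=a}^{b} f k   (0 if b < a)
  rsum : (ℕ → Carrier) → ℕ → ℕ → Carrier
  rsum f a b = foldr _⊕_ 0# (map f (range a b))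

  prodL : {A : Set} → (A → Carrier) → List A → Carrier
  prodL f xs = foldr _⊗_ 1# (map f xs)

  sumL : {A : Set} → (A → Carrier) → List A → Carrier
  sumL f xs = foldr _⊕_ 0# (map f xs)

  hookW : (ℕ → Carrier) → (ℕ → Carrier) → List ℕ → ℕ × ℕ → Carrier
  hookW x y l (i , j) = rsum x i (conj l j) ⊕ rsum y j (part l i)

  lhs : (ℕ → Carrier) → (ℕ → Carrier) → List ℕ → Carrier
  lhs x y l = prodL (hookW x y l) (cells l)

  cornerTerm : (ℕ → Carrier) → (ℕ → Carrier) → List ℕ → ℕ × ℕ → Carrier
  cornerTerm x y l (r , s) =
    (prodL (hookW x y l)
       (filterᵇ (λ c → not (proj₁ c ≡ᵇ r) ∧ not (proj₂ c ≡ᵇ s)) (cells l))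
     ⊗ prodL (λ i → rsum x (suc i) (r ∸ 1) ⊕ rsum y s (part l i)) (range 1 (r ∸ 1)))
    ⊗ prodL (λ j → rsum x r (conj l j) ⊕ rsum y (suc j) (s ∸ 1)) (range 1 (s ∸ 1))

  rhs : (ℕ → Carrier) → (ℕ → Carrier) → List ℕ → Carrier
  rhs x y l = sumL (cornerTerm x y l) (outerCorners l)

module Submission where

-- Write λ = a ∷ μ. The cells of [λ] are its first row together with [μ] moved one row
-- down, and the outer corners of λ are (1 , a + 1) together with the outer corners of μ in
-- columns ≤ a moved one row down (outerCorners-∷). Rewriting every hook of λ below the first
-- row as the hook of μ in the shifted variables x_2, x_3, ... (lhs-∷, cornerTerm-first,
-- cornerTerm-lower) turns the theorem for λ into an identity `Peeled μ a x z` that mentions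
-- only μ, the length a of the first row and the first x-variable z = x_1.
--
-- Peeled is proved by induction on μ = b ∷ ν for all z at once (FirstRowIdentity.peeled):
-- the first-row hooks split at column b, and the identity for μ follows from Peeled ν b at
-- the two values z + x_1 + y_{b+1} + ... + y_a and x_1 of the first variable, after ring
-- normalisation. The cases b < a and b = a differ in whether (1 , b + 1) is a corner that
-- survives into λ (Step.Short, Step.Flush).

open import Defs
open import Function using (_∘_)
open import Data.Bool using (Bool; true; false; not; T; _∧_; _∨_)
open import Data.Bool.Properties using (∧-zeroʳ; ∧-identityʳ)
open import Data.Unit using (tt)
open import Data.List using (List; []; _∷_; map; foldr; concat; concatMap; upTo; applyUpTo; filterᵇ; length; _++_)
open import Data.List.Properties
  using (map-∘; map-cong; map-cong-local; map-upTo; concatMap-map; map-concatMap; ++-identityʳ;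
         filter-++; filter-accept; filter-reject; filter-all; filter-none)
open import Data.List.Membership.Propositional using (_∈_)
open import Data.List.Membership.Propositional.Properties using (∈-map⁻; ∈-upTo⁻)
open import Data.List.Relation.Unary.All as All using (All; []; _∷_)
open import Data.List.Relation.Unary.All.Properties using (map⁺; concat⁺; filter⁺; all-filter)
open import Data.List.Relation.Unary.Linked using (Linked; []; [-]; _∷_)
open import Data.Nat using (ℕ; zero; suc; _∸_; _≤_; _<_; _≥_; _≤ᵇ_; _≡ᵇ_; z≤n; s≤s)
import Data.Nat.Properties as ℕₚ
open ℕₚ using (≤-refl; ≤-trans; ≤-reflexive; ≤-pred; ≤-<-trans; <-≤-trans; <⇒≤; <-irrefl; <⇒≱; ≰⇒>;
               _≤?_; n≤1+n; m∸n≤m; ≤⇒≤ᵇ; ≤ᵇ⇒≤; ≡ᵇ⇒≡; ≡⇒≡ᵇ)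
open import Data.Product using (_×_; _,_; proj₁; proj₂)
import Relation.Binary.PropositionalEquality as ≡
open ≡ using (_≡_; _≢_)
open import Relation.Nullary using (¬_; yes; no; contradiction)
open import Relation.Nullary.Decidable using (T?)
open import Algebra.Bundles using (CommutativeRing)

module Ranges where
  open import Data.Nat using (_+_)
  open ≡ using (refl; sym; trans; cong; cong₂; subst)
  open ≡.≡-Reasoning

  open ℕₚ using (+-identityʳ; +-suc; +-∸-assoc; +-monoʳ-<; m≤n⇒m∸n≡0; m∸n+n≡m; m+[n∸m]≡n; m∸n≢0⇒n<m;
                 suc-injective; m≤n+m; m≤m+n; n≮0)

  range-∷ : ∀ {m n} → m ≤ n → range m n ≡ m ∷ range (suc m) n
  range-∷ {m} {n} m≤n rewrite +-∸-assoc 1 m≤n = cong₂ _∷_ (+-identityʳ m) (begin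
    map (m +_) (applyUpTo suc (n ∸ m))        ≡⟨ cong (map (m +_)) (map-upTo suc (n ∸ m)) ⟨
    map (m +_) (map suc (upTo (n ∸ m)))       ≡⟨ map-∘ (upTo (n ∸ m)) ⟨
    map (λ i → m + suc i) (upTo (n ∸ m))      ≡⟨ map-cong (+-suc m) (upTo (n ∸ m)) ⟩
    range (suc m) n                           ∎)

  range-[] : ∀ {m n} → n < m → range m n ≡ []
  range-[] n<m rewrite m≤n⇒m∸n≡0 n<m = refl

  map-suc-range : ∀ m n → map suc (range m n) ≡ range (suc m) (suc n)
  map-suc-range m n = sym (map-∘ (upTo (suc n ∸ m)))

  range-++ : ∀ {m k n} → m ≤ suc k → k ≤ n → range m n ≡ range m k ++ range (suc k) n
  range-++ {m} {k} {n} m≤k+1 k≤n = go (suc k ∸ m) m (m∸n+n≡m m≤k+1)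
    where
    go : ∀ d m → d + m ≡ suc k → range m n ≡ range m k ++ range (suc k) n
    go zero    m refl rewrite range-[] {suc k} {k} ≤-refl = refl
    go (suc d) m d+m≡k+1 = begin
      range m n                                 ≡⟨ range-∷ (≤-trans m≤k k≤n) ⟩
      m ∷ range (suc m) n                       ≡⟨ cong (m ∷_) (go d (suc m) (trans (+-suc d m) d+m≡k+1)) ⟩
      m ∷ range (suc m) k ++ range (suc k) n    ≡⟨ cong (_++ range (suc k) n) (range-∷ m≤k) ⟨
      range m k ++ range (suc k) n              ∎
      where
      m≤k : m ≤ k
      m≤k = ≤-trans (m≤n+m m d) (≤-reflexive (suc-injective d+m≡k+1))

  range-∷ʳ : ∀ {m n} → m ≤ suc n → range m (suc n) ≡ range m n ++ suc n ∷ []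
  range-∷ʳ {m} {n} m≤n+1 = begin
    range m (suc n)                         ≡⟨ range-++ m≤n+1 (n≤1+n n) ⟩
    range m n ++ range (suc n) (suc n)      ≡⟨ cong (range m n ++_) (range-∷ ≤-refl) ⟩
    range m n ++ suc n ∷ range (suc (suc n)) (suc n)
                                            ≡⟨ cong (λ l → range m n ++ suc n ∷ l) (range-[] ≤-refl) ⟩
    range m n ++ suc n ∷ []                 ∎

  range-bounds : ∀ m n → All (λ j → m ≤ j × j ≤ n) (range m n)
  range-bounds m n = All.tabulate bounds
    where
    bounds : ∀ {j} → j ∈ range m n → m ≤ j × j ≤ n
    bounds j∈ with i , i∈ , refl ← ∈-map⁻ (m +_) j∈ = m≤m+n m i , ≤-pred m+i<n+1
      where
      i<d : i < suc n ∸ m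
      i<d = ∈-upTo⁻ i∈
      m<n+1 : m < suc n
      m<n+1 = m∸n≢0⇒n<m (λ d≡0 → n≮0 (subst (i <_) d≡0 i<d))
      m+i<n+1 : m + i < suc n
      m+i<n+1 = <-≤-trans (+-monoʳ-< m i<d) (≤-reflexive (m+[n∸m]≡n (<⇒≤ m<n+1)))

open Ranges

module Filters where
  open ≡ using (refl; trans; cong; cong₂)
  open ≡.≡-Reasoning

  ¬T-false : ∀ {b} → b ≡ false → ¬ T b
  ¬T-false refl ()

  ≤ᵇ-true : ∀ {m n} → m ≤ n → (m ≤ᵇ n) ≡ true
  ≤ᵇ-true {m} {n} m≤n with m ≤ᵇ n | ≤⇒≤ᵇ m≤n
  ... | true | _ = refl

  ≤ᵇ-false : ∀ {m n} → n < m → (m ≤ᵇ n) ≡ false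
  ≤ᵇ-false {m} {n} n<m with m ≤ᵇ n | ≤ᵇ⇒≤ m n
  ... | true  | le = contradiction (le tt) (<⇒≱ n<m)
  ... | false | _  = refl

  ¬T-≤ᵇ : ∀ {m n} → n < m → ¬ T (m ≤ᵇ n)
  ¬T-≤ᵇ n<m = ¬T-false (≤ᵇ-false n<m)

  T-not-≡ᵇ : ∀ {m n} → m ≢ n → T (not (m ≡ᵇ n))
  T-not-≡ᵇ {m} {n} m≢n with m ≡ᵇ n | ≡ᵇ⇒≡ m n
  ... | true  | eq = m≢n (eq tt)
  ... | false | _  = tt

  ¬T-not-≡ᵇ-refl : ∀ n → ¬ T (not (n ≡ᵇ n))
  ¬T-not-≡ᵇ-refl n t with n ≡ᵇ n | ≡⇒≡ᵇ n n refl
  ... | true  | _ = t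
  ... | false | ()

  module _ {A : Set} where

    filterᵇ-congᴬ : ∀ {p q : A → Bool} {xs} → All (λ x → p x ≡ q x) xs → filterᵇ p xs ≡ filterᵇ q xs
    filterᵇ-congᴬ {p} {q} {[]}     []         = refl
    filterᵇ-congᴬ {p} {q} {x ∷ xs} (e ∷ es) with p x | q x
    filterᵇ-congᴬ (refl ∷ es) | true  | true  = cong (_ ∷_) (filterᵇ-congᴬ es)
    filterᵇ-congᴬ (refl ∷ es) | false | false = filterᵇ-congᴬ es

    filterᵇ-filterᵇ : ∀ (p q : A → Bool) xs → filterᵇ p (filterᵇ q xs) ≡ filterᵇ (λ x → q x ∧ p x) xs
    filterᵇ-filterᵇ p q [] = refl
    filterᵇ-filterᵇ p q (x ∷ xs) with q x
    ... | false = filterᵇ-filterᵇ p q xs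
    ... | true with p x
    ...   | true  = cong (x ∷_) (filterᵇ-filterᵇ p q xs)
    ...   | false = filterᵇ-filterᵇ p q xs

  module _ {A B : Set} where

    filterᵇ-map : ∀ (p : B → Bool) (f : A → B) xs → filterᵇ p (map f xs) ≡ map f (filterᵇ (p ∘ f) xs)
    filterᵇ-map p f [] = refl
    filterᵇ-map p f (x ∷ xs) with p (f x)
    ... | true  = cong (f x ∷_) (filterᵇ-map p f xs)
    ... | false = filterᵇ-map p f xs

    filterᵇ-concatMap : ∀ (p : B → Bool) (f : A → List B) xs →
      filterᵇ p (concatMap f xs) ≡ concatMap (filterᵇ p ∘ f) xs
    filterᵇ-concatMap p f [] = refl
    filterᵇ-concatMap p f (x ∷ xs) =
      trans (filter-++ (T? ∘ p) (f x) (concatMap f xs)) (cong (filterᵇ p (f x) ++_) (filterᵇ-concatMap p f xs))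

    concatMap-congᴬ : ∀ {f g : A → List B} {xs} → All (λ x → f x ≡ g x) xs → concatMap f xs ≡ concatMap g xs
    concatMap-congᴬ es = cong concat (map-cong-local es)

  range-omit : ∀ {s n} → 1 ≤ s → s ≤ n → filterᵇ (λ j → not (j ≡ᵇ s)) (range 1 n) ≡ range 1 (s ∸ 1) ++ range (suc s) n
  range-omit {suc s} {n} _ s<n = begin
    filterᵇ keep (range 1 n)
      ≡⟨ cong (filterᵇ keep) (range-++ {1} {s} {n} (s≤s z≤n) (≤-trans (n≤1+n s) s<n)) ⟩
    filterᵇ keep (range 1 s ++ range (suc s) n)
      ≡⟨ cong (λ l → filterᵇ keep (range 1 s ++ l)) (range-∷ s<n) ⟩
    filterᵇ keep (range 1 s ++ suc s ∷ range (suc (suc s)) n)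
      ≡⟨ filter-++ (T? ∘ keep) (range 1 s) _ ⟩
    filterᵇ keep (range 1 s) ++ filterᵇ keep (suc s ∷ range (suc (suc s)) n)
      ≡⟨ cong (filterᵇ keep (range 1 s) ++_) (filter-reject (T? ∘ keep) {suc s} {range (suc (suc s)) n} (¬T-not-≡ᵇ-refl (suc s))) ⟩
    filterᵇ keep (range 1 s) ++ filterᵇ keep (range (suc (suc s)) n)
      ≡⟨ cong₂ _++_ (filter-all (T? ∘ keep) (All.map (λ {j} (_ , j≤s) → T-not-≡ᵇ {j} (λ { refl → <-irrefl refl j≤s })) (range-bounds 1 s)))
                    (filter-all (T? ∘ keep) (All.map (λ {j} (s+2≤j , _) → T-not-≡ᵇ {j} (λ { refl → <-irrefl refl s+2≤j }))
                                                     (range-bounds (suc (suc s)) n))) ⟩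
    range 1 s ++ range (suc (suc s)) n ∎
    where
    keep : ℕ → Bool
    keep j = not (j ≡ᵇ suc s)

open Filters

module BigOperators {c ℓ} (R : CommutativeRing c ℓ) where
  open CommutativeRing R
  open import Algebra.Properties.CommutativeSemigroup +-commutativeSemigroup using (interchange)
  open import Algebra.Properties.CommutativeSemigroup *-commutativeSemigroup using (x∙yz≈y∙xz)

  Π : {A : Set} → (A → Carrier) → List A → Carrier
  Π = prodL R

  ∑ : {A : Set} → (A → Carrier) → List A → Carrier
  ∑ = sumL R

  rs : (ℕ → Carrier) → ℕ → ℕ → Carrier
  rs = rsum R

  module _ {A : Set} where

    Π-++ : ∀ (f : A → Carrier) xs ys → Π f (xs ++ ys) ≈ Π f xs * Π f ys
    Π-++ f []       ys = sym (*-identityˡ _)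
    Π-++ f (x ∷ xs) ys = trans (*-congˡ (Π-++ f xs ys)) (sym (*-assoc _ _ _))

    ∑-++ : ∀ (f : A → Carrier) xs ys → ∑ f (xs ++ ys) ≈ ∑ f xs + ∑ f ys
    ∑-++ f []       ys = sym (+-identityˡ _)
    ∑-++ f (x ∷ xs) ys = trans (+-congˡ (∑-++ f xs ys)) (sym (+-assoc _ _ _))

    Π-congᴬ : ∀ {f g : A → Carrier} {xs} → All (λ x → f x ≈ g x) xs → Π f xs ≈ Π g xs
    Π-congᴬ []       = refl
    Π-congᴬ (e ∷ es) = *-cong e (Π-congᴬ es)

    ∑-congᴬ : ∀ {f g : A → Carrier} {xs} → All (λ x → f x ≈ g x) xs → ∑ f xs ≈ ∑ g xs
    ∑-congᴬ []       = refl
    ∑-congᴬ (e ∷ es) = +-cong e (∑-congᴬ es)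

    ∑-*ˡ : ∀ (k : Carrier) (f : A → Carrier) xs → ∑ (λ x → k * f x) xs ≈ k * ∑ f xs
    ∑-*ˡ k f []       = sym (zeroʳ k)
    ∑-*ˡ k f (x ∷ xs) = trans (+-congˡ (∑-*ˡ k f xs)) (sym (distribˡ k _ _))

    ∑-+ : ∀ (f g : A → Carrier) xs → ∑ (λ x → f x + g x) xs ≈ ∑ f xs + ∑ g xs
    ∑-+ f g []       = sym (+-identityˡ 0#)
    ∑-+ f g (x ∷ xs) = trans (+-congˡ (∑-+ f g xs)) (interchange _ _ _ _)

  module _ {A B : Set} where

    Π-map : ∀ (f : B → Carrier) (g : A → B) xs → Π f (map g xs) ≡ Π (f ∘ g) xs
    Π-map f g xs = ≡.cong (foldr _*_ 1#) (≡.sym (map-∘ xs))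

    ∑-map : ∀ (f : B → Carrier) (g : A → B) xs → ∑ f (map g xs) ≡ ∑ (f ∘ g) xs
    ∑-map f g xs = ≡.cong (foldr _+_ 0#) (≡.sym (map-∘ xs))

  rs-∷ : ∀ x {m n} → m ≤ n → rs x m n ≈ x m + rs x (suc m) n
  rs-∷ x m≤n rewrite range-∷ m≤n = refl

  rs-[] : ∀ x {m n} → n < m → rs x m n ≈ 0#
  rs-[] x n<m rewrite range-[] n<m = refl

  rs-++ : ∀ x {m k n} → m ≤ suc k → k ≤ n → rs x m n ≈ rs x m k + rs x (suc k) n
  rs-++ x {m} {k} {n} m≤k+1 k≤n rewrite range-++ m≤k+1 k≤n = ∑-++ x (range m k) (range (suc k) n)

  rs-shift : ∀ x i k → rs x (suc i) (suc k) ≡ rs (x ∘ suc) i k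
  rs-shift x i k = ≡.trans (≡.cong (∑ x) (≡.sym (map-suc-range i k))) (∑-map x suc (range i k))

  rs-shift′ : ∀ x {i} k → 1 ≤ i → rs x (suc i) k ≈ rs (x ∘ suc) i (k ∸ 1)
  rs-shift′ x {i} (suc k) _ = reflexive (rs-shift x i k)
  rs-shift′ x {i} zero  1≤i = trans (rs-[] x {suc i} {0} (s≤s z≤n)) (sym (rs-[] (x ∘ suc) {i} {0} 1≤i))

  rs-1+ : ∀ x k → rs x 1 (suc k) ≈ x 1 + rs (x ∘ suc) 1 k
  rs-1+ x k = trans (rs-∷ x {1} {suc k} (s≤s z≤n)) (+-congˡ (reflexive (rs-shift x 1 k)))

  Π-∷ʳ : ∀ (f : ℕ → Carrier) {m n} → m ≤ suc n → Π f (range m (suc n)) ≈ Π f (range m n) * f (suc n)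
  Π-∷ʳ f {m} {n} m≤n+1 rewrite range-∷ʳ m≤n+1 =
    trans (Π-++ f (range m n) (suc n ∷ [])) (*-congˡ (*-identityʳ (f (suc n))))

  Π-omit : (ℕ → Carrier) → ℕ → ℕ → Carrier
  Π-omit f n s = Π f (range 1 (s ∸ 1)) * Π f (range (suc s) n)

  Π-extract : ∀ (f : ℕ → Carrier) {n s} → 1 ≤ s → s ≤ n → Π f (range 1 n) ≈ f s * Π-omit f n s
  Π-extract f {n} {suc s} _ s<n rewrite range-++ {1} {s} {n} (s≤s z≤n) (≤-trans (n≤1+n s) s<n) | range-∷ s<n =
    trans (Π-++ f (range 1 s) (suc s ∷ range (suc (suc s)) n)) (x∙yz≈y∙xz _ _ _)

  Π-suc : ∀ (f : ℕ → Carrier) {m n} → m ≤ n → Π (f ∘ suc) (range m n) ≈ Π f (range (suc m) n) * f (suc n)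
  Π-suc f {m} {n} m≤n =
    trans (reflexive (≡.trans (≡.sym (Π-map f suc (range m n))) (≡.cong (Π f) (map-suc-range m n))))
          (Π-∷ʳ f (s≤s m≤n))

module Diagrams where
  open ≡ using (refl; sym; trans; cong; cong₂)
  open ≡.≡-Reasoning

  PartsAtMost : ℕ → List ℕ → Set
  PartsAtMost a μ = All (_≤ a) μ

  part-≤ : ∀ {a} μ i → PartsAtMost a μ → part μ i ≤ a
  part-≤ []      zero          _        = z≤n
  part-≤ []      (suc i)       _        = z≤n
  part-≤ (b ∷ μ) zero          _        = z≤n
  part-≤ (b ∷ μ) (suc zero)    (b≤a ∷ _) = b≤a
  part-≤ (b ∷ μ) (suc (suc i)) (_ ∷ μ≤a) = part-≤ μ (suc i) μ≤a

  part-∷ : ∀ a μ {i} → 1 ≤ i → part (a ∷ μ) (suc i) ≡ part μ i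
  part-∷ a μ {suc i} _ = refl

  conj-∷-≤ : ∀ a μ {j} → j ≤ a → conj (a ∷ μ) j ≡ suc (conj μ j)
  conj-∷-≤ a μ {j} j≤a = cong length (filter-accept (T? ∘ (j ≤ᵇ_)) (≤⇒≤ᵇ j≤a))

  conj-∷-> : ∀ a μ {j} → a < j → conj (a ∷ μ) j ≡ conj μ j
  conj-∷-> a μ {j} a<j = cong length (filter-reject (T? ∘ (j ≤ᵇ_)) (¬T-≤ᵇ a<j))

  conj-beyond : ∀ μ {j} → All (_< j) μ → conj μ j ≡ 0
  conj-beyond μ {j} μ<j = cong length (filter-none (T? ∘ (j ≤ᵇ_)) (All.map ¬T-≤ᵇ μ<j))

  conj-∷-pred : ∀ a μ j → PartsAtMost a μ → conj (a ∷ μ) j ∸ 1 ≡ conj μ j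
  conj-∷-pred a μ j μ≤a with j ≤? a
  ... | yes j≤a = cong (_∸ 1) (conj-∷-≤ a μ j≤a)
  ... | no  j≰a = trans (cong (_∸ 1) (trans (conj-∷-> a μ a<j) empty)) (sym empty)
    where
    a<j : a < j
    a<j = ≰⇒> j≰a
    empty : conj μ j ≡ 0
    empty = conj-beyond μ (All.map (λ b≤a → ≤-<-trans b≤a a<j) μ≤a)

  head-positive : ∀ {a μ} → IsPartition (a ∷ μ) → 1 ≤ a
  head-positive (1≤a ∷ _ , _) = 1≤a

  tail-partition : ∀ {a μ} → IsPartition (a ∷ μ) → IsPartition μ
  tail-partition (_ ∷ pos , [-])        = pos , []
  tail-partition (_ ∷ pos , (_ ∷ dec)) = pos , dec

  tail-≤-head : ∀ {a μ} → IsPartition (a ∷ μ) → PartsAtMost a μ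
  tail-≤-head (_ , dec) = bounded dec
    where
    bounded : ∀ {a μ} → Linked _≥_ (a ∷ μ) → PartsAtMost a μ
    bounded [-]           = []
    bounded (b≤a ∷ [-])   = b≤a ∷ []
    bounded (b≤a ∷ (c≤b ∷ dec)) = b≤a ∷ All.map (λ d≤b → ≤-trans d≤b b≤a) (bounded (c≤b ∷ dec))

  part-≤-first : ∀ μ i → IsPartition μ → part μ i ≤ part μ 1
  part-≤-first []      zero    _ = z≤n
  part-≤-first []      (suc i) _ = z≤n
  part-≤-first (b ∷ ν) zero    _ = z≤n
  part-≤-first (b ∷ ν) (suc zero) _ = ≤-refl
  part-≤-first (b ∷ ν) (suc (suc i)) p = part-≤ ν (suc i) (tail-≤-head p)

  shift : ℕ × ℕ → ℕ × ℕ
  shift (i , j) = (suc i , j)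

  row : List ℕ → ℕ → List (ℕ × ℕ)
  row l i = map (i ,_) (range 1 (part l i))

  row-∷ : ∀ a μ {i} → 1 ≤ i → row (a ∷ μ) (suc i) ≡ map shift (row μ i)
  row-∷ a μ {suc i} _ = map-∘ (range 1 (part μ (suc i)))

  cells-∷ : ∀ a μ → cells (a ∷ μ) ≡ map (1 ,_) (range 1 a) ++ map shift (cells μ)
  cells-∷ a μ = begin
    cells (a ∷ μ)
      ≡⟨ cong (concatMap (row (a ∷ μ))) (range-∷ {1} {suc L} (s≤s z≤n)) ⟩
    firstRow ++ concatMap (row (a ∷ μ)) (range 2 (suc L))
      ≡⟨ cong (λ is → firstRow ++ concatMap (row (a ∷ μ)) is) (sym (map-suc-range 1 L)) ⟩
    firstRow ++ concatMap (row (a ∷ μ)) (map suc (range 1 L))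
      ≡⟨ cong (firstRow ++_) (concatMap-map (row (a ∷ μ)) suc (range 1 L)) ⟩
    firstRow ++ concatMap (row (a ∷ μ) ∘ suc) (range 1 L)
      ≡⟨ cong (firstRow ++_) (concatMap-congᴬ (All.map (λ (1≤i , _) → row-∷ a μ 1≤i) (range-bounds 1 L))) ⟩
    firstRow ++ concatMap (map shift ∘ row μ) (range 1 L)
      ≡⟨ cong (firstRow ++_) (sym (map-concatMap shift (row μ) (range 1 L))) ⟩
    firstRow ++ map shift (cells μ) ∎
    where
    L : ℕ
    L = length μ
    firstRow : List (ℕ × ℕ)
    firstRow = map (1 ,_) (range 1 a)

  InDiagram : List ℕ → ℕ × ℕ → Set
  InDiagram μ (i , j) = 1 ≤ i × 1 ≤ j × j ≤ part μ i

  cells-inDiagram : ∀ μ → All (InDiagram μ) (cells μ)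
  cells-inDiagram μ = concat⁺ (map⁺ (All.map rowInside (range-bounds 1 (length μ))))
    where
    rowInside : ∀ {i} → 1 ≤ i × i ≤ length μ → All (InDiagram μ) (row μ i)
    rowInside (1≤i , _) = map⁺ (All.map (λ bounds → 1≤i , bounds) (range-bounds 1 _))

  isCorner : List ℕ → ℕ × ℕ → Bool
  isCorner l c = isOuterCorner l (proj₁ c) (proj₂ c)

  inDiagram-beyond : ∀ l i {j} → part l i < j → inDiagram l i j ≡ false
  inDiagram-beyond l i {j} lt rewrite ≤ᵇ-false lt
    | ∧-zeroʳ (i ≤ᵇ length l) | ∧-zeroʳ (1 ≤ᵇ j) | ∧-zeroʳ (1 ≤ᵇ i) = refl

  isOuterCorner-∷ : ∀ a μ → PartsAtMost a μ → ∀ {i j} → 1 ≤ i → 1 ≤ j →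
    isOuterCorner (a ∷ μ) (suc i) j ≡ isOuterCorner μ i j ∧ (j ≤ᵇ a)
  isOuterCorner-∷ a μ μ≤a {suc zero} {suc j} _ _ = ∧-rearrange (not (inDiagram μ 1 (suc j))) _ (suc j ≤ᵇ a)
    where
    ∧-rearrange : ∀ n c d → n ∧ (d ∧ c) ≡ (n ∧ c) ∧ d
    ∧-rearrange false c d     = refl
    ∧-rearrange true  c false = sym (∧-zeroʳ c)
    ∧-rearrange true  c true  = sym (∧-identityʳ c)
  isOuterCorner-∷ a μ μ≤a {suc (suc i)} {j} _ _ with j ≤? a
  ... | yes j≤a rewrite ≤ᵇ-true j≤a = sym (∧-identityʳ _)
  ... | no  j≰a rewrite ≤ᵇ-false (≰⇒> j≰a) | inDiagram-beyond μ (suc i) (≤-<-trans (part-≤ μ (suc i) μ≤a) (≰⇒> j≰a))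
    = trans (∧-zeroʳ (not (inDiagram μ (suc (suc i)) j))) (sym (∧-zeroʳ _))

  isOuterCorner-far : ∀ μ → IsPartition μ → ∀ i {j} → suc (suc (part μ 1)) ≤ j → isOuterCorner μ i j ≡ false
  isOuterCorner-far μ p i {suc (suc j)} (s≤s j>μ₁)
    rewrite inDiagram-beyond μ i (≤-<-trans (part-≤-first μ i p) j>μ₁)
    = ∧-false (not (inDiagram μ i (suc (suc j)))) ((i ≡ᵇ 1) ∨ inDiagram μ (i ∸ 1) (suc (suc j)))
    where
    ∧-false : ∀ a b → a ∧ (b ∧ false) ≡ false
    ∧-false false b = refl
    ∧-false true  b = ∧-zeroʳ b

  firstRow-notCorner : ∀ a μ {j} → 1 ≤ j → j ≤ a → ¬ T (isOuterCorner (a ∷ μ) 1 j)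
  firstRow-notCorner a μ {suc j} _ j<a rewrite ≤ᵇ-true j<a = λ ()

  firstRow-corner : ∀ a μ → 1 ≤ a → T (isOuterCorner (a ∷ μ) 1 (suc a))
  firstRow-corner (suc a) μ _ rewrite ≤ᵇ-false {suc (suc a)} {suc a} ≤-refl | ≤ᵇ-true {suc a} {suc a} ≤-refl = _

  candidates : ℕ → ℕ → List (ℕ × ℕ)
  candidates w i = map (i ,_) (range 1 (suc w))

  firstRow-corners : ∀ a μ → 1 ≤ a → filterᵇ (isCorner (a ∷ μ)) (candidates a 1) ≡ (1 , suc a) ∷ []
  firstRow-corners a μ 1≤a = begin
    filterᵇ (isCorner (a ∷ μ)) (candidates a 1)
      ≡⟨ filterᵇ-map (isCorner (a ∷ μ)) (1 ,_) (range 1 (suc a)) ⟩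
    map (1 ,_) (filterᵇ p (range 1 (suc a)))
      ≡⟨ cong (map (1 ,_) ∘ filterᵇ p) (range-∷ʳ (s≤s z≤n)) ⟩
    map (1 ,_) (filterᵇ p (range 1 a ++ suc a ∷ []))
      ≡⟨ cong (map (1 ,_)) (filter-++ (T? ∘ p) (range 1 a) (suc a ∷ [])) ⟩
    map (1 ,_) (filterᵇ p (range 1 a) ++ filterᵇ p (suc a ∷ []))
      ≡⟨ cong (map (1 ,_)) (cong₂ _++_
           (filter-none (T? ∘ p) (All.map (λ (1≤j , j≤a) → firstRow-notCorner a μ 1≤j j≤a) (range-bounds 1 a)))
           (filter-accept (T? ∘ p) (firstRow-corner a μ 1≤a))) ⟩
    (1 , suc a) ∷ [] ∎
    where
    p : ℕ → Bool
    p j = isOuterCorner (a ∷ μ) 1 j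

  lowerRow-corners : ∀ a μ → PartsAtMost a μ → IsPartition μ → ∀ {i} → 1 ≤ i →
    filterᵇ (isCorner (a ∷ μ)) (candidates a (suc i))
      ≡ map shift (filterᵇ (λ c → isCorner μ c ∧ (proj₂ c ≤ᵇ a)) (candidates (part μ 1) i))
  lowerRow-corners a μ μ≤a pμ {i} 1≤i = begin
    filterᵇ (isCorner (a ∷ μ)) (candidates a (suc i))
      ≡⟨ filterᵇ-map (isCorner (a ∷ μ)) (suc i ,_) (range 1 (suc a)) ⟩
    map (suc i ,_) (filterᵇ p (range 1 (suc a)))
      ≡⟨ cong (map (suc i ,_) ∘ filterᵇ p) (range-++ (s≤s z≤n) (s≤s b≤a)) ⟩
    map (suc i ,_) (filterᵇ p (range 1 (suc b) ++ range (suc (suc b)) (suc a)))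
      ≡⟨ cong (map (suc i ,_)) (filter-++ (T? ∘ p) (range 1 (suc b)) _) ⟩
    map (suc i ,_) (filterᵇ p (range 1 (suc b)) ++ filterᵇ p (range (suc (suc b)) (suc a)))
      ≡⟨ cong (map (suc i ,_)) (cong₂ _++_
           (filterᵇ-congᴬ (All.map (λ (1≤j , _) → isOuterCorner-∷ a μ μ≤a 1≤i 1≤j) (range-bounds 1 (suc b))))
           (filter-none (T? ∘ p) (All.map (λ (b+2≤j , _) → ¬T-false (farFalse b+2≤j)) (range-bounds (suc (suc b)) (suc a))))) ⟩
    map (suc i ,_) (filterᵇ (q ∘ (i ,_)) (range 1 (suc b)) ++ [])
      ≡⟨ cong (map (suc i ,_)) (++-identityʳ _) ⟩
    map (shift ∘ (i ,_)) (filterᵇ (q ∘ (i ,_)) (range 1 (suc b)))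
      ≡⟨ map-∘ _ ⟩
    map shift (map (i ,_) (filterᵇ (q ∘ (i ,_)) (range 1 (suc b))))
      ≡⟨ cong (map shift) (filterᵇ-map q (i ,_) (range 1 (suc b))) ⟨
    map shift (filterᵇ q (candidates b i)) ∎
    where
    b : ℕ
    b = part μ 1
    b≤a : b ≤ a
    b≤a = part-≤ μ 1 μ≤a
    p : ℕ → Bool
    p j = isOuterCorner (a ∷ μ) (suc i) j
    q : ℕ × ℕ → Bool
    q c = isCorner μ c ∧ (proj₂ c ≤ᵇ a)
    farFalse : ∀ {j} → suc (suc b) ≤ j → p j ≡ false
    farFalse {j} b+2≤j = trans (isOuterCorner-∷ a μ μ≤a 1≤i (≤-trans (s≤s z≤n) b+2≤j))
                               (cong (_∧ (j ≤ᵇ a)) (isOuterCorner-far μ pμ i b+2≤j))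

  outerCorners-∷ : ∀ a μ → 1 ≤ a → PartsAtMost a μ → IsPartition μ →
    outerCorners (a ∷ μ) ≡ (1 , suc a) ∷ map shift (filterᵇ (λ c → proj₂ c ≤ᵇ a) (outerCorners μ))
  outerCorners-∷ a μ 1≤a μ≤a pμ = begin
    outerCorners (a ∷ μ)
      ≡⟨ cong (filterᵇ P ∘ concatMap (candidates a)) (range-∷ {1} {suc (suc L)} (s≤s z≤n)) ⟩
    filterᵇ P (candidates a 1 ++ concatMap (candidates a) (range 2 (suc (suc L))))
      ≡⟨ cong (λ is → filterᵇ P (candidates a 1 ++ concatMap (candidates a) is)) (sym (map-suc-range 1 (suc L))) ⟩
    filterᵇ P (candidates a 1 ++ concatMap (candidates a) (map suc R))
      ≡⟨ cong (λ cs → filterᵇ P (candidates a 1 ++ cs)) (concatMap-map (candidates a) suc R) ⟩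
    filterᵇ P (candidates a 1 ++ concatMap (candidates a ∘ suc) R)
      ≡⟨ filter-++ (T? ∘ P) (candidates a 1) _ ⟩
    filterᵇ P (candidates a 1) ++ filterᵇ P (concatMap (candidates a ∘ suc) R)
      ≡⟨ cong₂ _++_ (firstRow-corners a μ 1≤a) (filterᵇ-concatMap P (candidates a ∘ suc) R) ⟩
    (1 , suc a) ∷ concatMap (filterᵇ P ∘ candidates a ∘ suc) R
      ≡⟨ cong ((1 , suc a) ∷_)
              (concatMap-congᴬ (All.map (λ (1≤i , _) → lowerRow-corners a μ μ≤a pμ 1≤i) (range-bounds 1 (suc L)))) ⟩
    (1 , suc a) ∷ concatMap (map shift ∘ filterᵇ Q ∘ candidates b) R
      ≡⟨ cong ((1 , suc a) ∷_) (sym (map-concatMap shift (filterᵇ Q ∘ candidates b) R)) ⟩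
    (1 , suc a) ∷ map shift (concatMap (filterᵇ Q ∘ candidates b) R)
      ≡⟨ cong (λ cs → (1 , suc a) ∷ map shift cs) (sym (filterᵇ-concatMap Q (candidates b) R)) ⟩
    (1 , suc a) ∷ map shift (filterᵇ Q (concatMap (candidates b) R))
      ≡⟨ cong (λ cs → (1 , suc a) ∷ map shift cs)
              (sym (filterᵇ-filterᵇ (λ c → proj₂ c ≤ᵇ a) (isCorner μ) (concatMap (candidates b) R))) ⟩
    (1 , suc a) ∷ map shift (filterᵇ (λ c → proj₂ c ≤ᵇ a) (outerCorners μ)) ∎
    where
    L : ℕ
    L = length μ
    R : List ℕ
    R = range 1 (suc L)
    b : ℕ
    b = part μ 1
    P : ℕ × ℕ → Bool
    P = isCorner (a ∷ μ)
    Q : ℕ × ℕ → Bool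
    Q c = isCorner μ c ∧ (proj₂ c ≤ᵇ a)

  CornerFoot : List ℕ → ℕ × ℕ → Set
  CornerFoot μ (r , s) = 1 ≤ r × 1 ≤ s × conj μ s ≡ r ∸ 1

  cornersUpTo : ℕ → List ℕ → List (ℕ × ℕ)
  cornersUpTo a μ = filterᵇ (λ c → proj₂ c ≤ᵇ a) (outerCorners μ)

  outerCorners-foot : ∀ μ → IsPartition μ → All (CornerFoot μ) (outerCorners μ)
  cornersUpTo-foot : ∀ a μ → IsPartition μ → All (λ c → CornerFoot μ c × proj₂ c ≤ a) (cornersUpTo a μ)

  outerCorners-foot []      _ = (s≤s z≤n , s≤s z≤n , refl) ∷ []
  outerCorners-foot (a ∷ μ) p rewrite outerCorners-∷ a μ (head-positive p) (tail-≤-head p) (tail-partition p) =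
    (s≤s z≤n , s≤s z≤n , trans (conj-∷-> a μ ≤-refl) (conj-beyond μ (All.map s≤s (tail-≤-head p))))
    ∷ map⁺ (All.map shiftFoot (cornersUpTo-foot a μ (tail-partition p)))
    where
    shiftFoot : ∀ {c} → CornerFoot μ c × proj₂ c ≤ a → CornerFoot (a ∷ μ) (shift c)
    shiftFoot {suc r , s} ((_ , 1≤s , foot) , s≤a) = s≤s z≤n , 1≤s , trans (conj-∷-≤ a μ s≤a) (cong suc foot)

  cornersUpTo-foot a μ p =
    All.zip (filter⁺ (T? ∘ (λ c → proj₂ c ≤ᵇ a)) (outerCorners-foot μ p) ,
             All.map (λ {c} → ≤ᵇ⇒≤ (proj₂ c) a) (all-filter (T? ∘ (λ c → proj₂ c ≤ᵇ a)) (outerCorners μ)))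

  cells-∷-filter : ∀ (p : ℕ × ℕ → Bool) a μ →
    filterᵇ p (cells (a ∷ μ)) ≡ map (1 ,_) (filterᵇ (p ∘ (1 ,_)) (range 1 a)) ++ map shift (filterᵇ (p ∘ shift) (cells μ))
  cells-∷-filter p a μ =
    trans (cong (filterᵇ p) (cells-∷ a μ))
    (trans (filter-++ (T? ∘ p) (map (1 ,_) (range 1 a)) (map shift (cells μ)))
           (cong₂ _++_ (filterᵇ-map p (1 ,_) (range 1 a)) (filterᵇ-map p shift (cells μ))))

  cells-∷-withoutFirstRow : ∀ a μ → PartsAtMost a μ →
    filterᵇ (λ c → not (proj₁ c ≡ᵇ 1) ∧ not (proj₂ c ≡ᵇ suc a)) (cells (a ∷ μ)) ≡ map shift (cells μ)
  cells-∷-withoutFirstRow a μ μ≤a =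
    trans (cells-∷-filter p a μ)
      (cong₂ (λ l m → map (1 ,_) l ++ map shift m)
        (filter-none (T? ∘ (p ∘ (1 ,_))) (All.map (λ _ ()) (range-bounds 1 a)))
        (filter-all (T? ∘ (p ∘ shift)) (All.map keep (cells-inDiagram μ))))
    where
    p : ℕ × ℕ → Bool
    p c = not (proj₁ c ≡ᵇ 1) ∧ not (proj₂ c ≡ᵇ suc a)
    keep : ∀ {c} → InDiagram μ c → T (p (shift c))
    keep {suc i , j} (_ , _ , j≤μᵢ) =
      T-not-≡ᵇ {j} (λ { refl → <-irrefl refl (≤-trans j≤μᵢ (part-≤ μ (suc i) μ≤a)) })

open Diagrams

module FirstRow {c ℓ} (R : CommutativeRing c ℓ) (y : ℕ → CommutativeRing.Carrier R) where
  open CommutativeRing R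
  open BigOperators R
  open import Relation.Binary.Reasoning.Setoid setoid
  open import Algebra.Solver.Ring.NaturalCoefficients.Default commutativeSemiring

  -- The weight  z + x_1 + ... + x_{μ'_j} + y_k + ... + y_a : a first-row hook of a ∷ μ
  -- whose first x-variable is z and whose remaining x-variables are x_1, x_2, ... .
  firstHook : List ℕ → ℕ → (ℕ → Carrier) → Carrier → ℕ → ℕ → Carrier
  firstHook μ a x z k j = z + (rs x 1 (conj μ j) + rs y k a)

  -- the hook of cell (1 , j), and the factor of the corner (1 , a + 1) for column j
  hookRow hookRow⁺ : List ℕ → ℕ → (ℕ → Carrier) → Carrier → ℕ → Carrier
  hookRow  μ a x z j = firstHook μ a x z j j
  hookRow⁺ μ a x z j = firstHook μ a x z (suc j) j

  -- x_1 + ... + x_{r-1} + y_s + ... + y_a : the factor for row 1 in the product over the rows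
  -- above the corner (r + 1 , s) of a ∷ μ, with x the shifted variables.
  cornerGap : ℕ → (ℕ → Carrier) → ℕ × ℕ → Carrier
  cornerGap a x (r , s) = rs x 1 (r ∸ 1) + rs y s a

  column-∷ : ∀ a μ x w {j} → j ≤ a → rs x 1 (conj (a ∷ μ) j) + w ≈ x 1 + (rs (x ∘ suc) 1 (conj μ j) + w)
  column-∷ a μ x w {j} j≤a =
    trans (+-congʳ (trans (reflexive (≡.cong (rs x 1) (conj-∷-≤ a μ j≤a))) (rs-1+ x (conj μ j)))) (+-assoc _ _ _)

  firstRow-hooks : ∀ a μ x {js} → All (_≤ a) js → Π (hookW R x y (a ∷ μ)) (map (1 ,_) js) ≈ Π (hookRow μ a (x ∘ suc) (x 1)) js
  firstRow-hooks a μ x {js} js≤a =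
    trans (reflexive (Π-map (hookW R x y (a ∷ μ)) (1 ,_) js)) (Π-congᴬ (All.map (λ {j} → column-∷ a μ x (rs y j a)) js≤a))

  lowerRows-hooks : ∀ a μ x {cs} → PartsAtMost a μ → All (λ c → 1 ≤ proj₁ c) cs →
    Π (hookW R x y (a ∷ μ)) (map shift cs) ≈ Π (hookW R (x ∘ suc) y μ) cs
  lowerRows-hooks a μ x {cs} μ≤a rows≥1 =
    trans (reflexive (Π-map (hookW R x y (a ∷ μ)) shift cs)) (Π-congᴬ (All.map (λ {c} → shifted {c}) rows≥1))
    where
    shifted : ∀ {c} → 1 ≤ proj₁ c → hookW R x y (a ∷ μ) (shift c) ≈ hookW R (x ∘ suc) y μ c
    shifted {i , j} 1≤i = +-cong
      (trans (rs-shift′ x (conj (a ∷ μ) j) 1≤i) (reflexive (≡.cong (rs (x ∘ suc) i) (conj-∷-pred a μ j μ≤a))))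
      (reflexive (≡.cong (rs y j) (part-∷ a μ 1≤i)))

  lhs-∷ : ∀ a μ x → PartsAtMost a μ → lhs R x y (a ∷ μ) ≈ Π (hookRow μ a (x ∘ suc) (x 1)) (range 1 a) * lhs R (x ∘ suc) y μ
  lhs-∷ a μ x μ≤a = begin
    Π (hookW R x y (a ∷ μ)) (cells (a ∷ μ))
      ≡⟨ ≡.cong (Π (hookW R x y (a ∷ μ))) (cells-∷ a μ) ⟩
    Π (hookW R x y (a ∷ μ)) (map (1 ,_) (range 1 a) ++ map shift (cells μ))
      ≈⟨ Π-++ (hookW R x y (a ∷ μ)) (map (1 ,_) (range 1 a)) (map shift (cells μ)) ⟩
    Π (hookW R x y (a ∷ μ)) (map (1 ,_) (range 1 a)) * Π (hookW R x y (a ∷ μ)) (map shift (cells μ))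
      ≈⟨ *-cong (firstRow-hooks a μ x (All.map proj₂ (range-bounds 1 a)))
                (lowerRows-hooks a μ x μ≤a (All.map proj₁ (cells-inDiagram μ))) ⟩
    Π (hookRow μ a (x ∘ suc) (x 1)) (range 1 a) * lhs R (x ∘ suc) y μ ∎

  offCornerHooks rowsAbove columnsLeft : List ℕ → (ℕ → Carrier) → ℕ × ℕ → Carrier
  offCornerHooks l x (r , s) = Π (hookW R x y l) (filterᵇ (λ c → not (proj₁ c ≡ᵇ r) ∧ not (proj₂ c ≡ᵇ s)) (cells l))
  rowsAbove      l x (r , s) = Π (λ i → rs x (suc i) (r ∸ 1) + rs y s (part l i)) (range 1 (r ∸ 1))
  columnsLeft    l x (r , s) = Π (λ j → rs x r (conj l j) + rs y (suc j) (s ∸ 1)) (range 1 (s ∸ 1))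

  cornerTerm-first : ∀ a μ x → PartsAtMost a μ →
    cornerTerm R x y (a ∷ μ) (1 , suc a) ≈ Π (hookRow⁺ μ a (x ∘ suc) (x 1)) (range 1 a) * lhs R (x ∘ suc) y μ
  cornerTerm-first a μ x μ≤a = begin
    (offCornerHooks (a ∷ μ) x (1 , suc a) * 1#) * columnsLeft (a ∷ μ) x (1 , suc a)
      ≈⟨ *-cong (*-congʳ offCorner) leftCols ⟩
    (lhs R (x ∘ suc) y μ * 1#) * Π (hookRow⁺ μ a (x ∘ suc) (x 1)) (range 1 a)
      ≈⟨ trans (*-congʳ (*-identityʳ _)) (*-comm _ _) ⟩
    Π (hookRow⁺ μ a (x ∘ suc) (x 1)) (range 1 a) * lhs R (x ∘ suc) y μ ∎
    where
    offCorner : offCornerHooks (a ∷ μ) x (1 , suc a) ≈ lhs R (x ∘ suc) y μ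
    offCorner = trans (reflexive (≡.cong (Π (hookW R x y (a ∷ μ))) (cells-∷-withoutFirstRow a μ μ≤a)))
                      (lowerRows-hooks a μ x μ≤a (All.map proj₁ (cells-inDiagram μ)))
    leftCols : columnsLeft (a ∷ μ) x (1 , suc a) ≈ Π (hookRow⁺ μ a (x ∘ suc) (x 1)) (range 1 a)
    leftCols = Π-congᴬ (All.map (λ {j} (_ , j≤a) → column-∷ a μ x (rs y (suc j) a) j≤a) (range-bounds 1 a))

  offCornerHooks-∷ : ∀ a μ x {r s} → PartsAtMost a μ → 1 ≤ r → 1 ≤ s → s ≤ a →
    offCornerHooks (a ∷ μ) x (suc r , s)
      ≈ Π-omit (hookRow μ a (x ∘ suc) (x 1)) a s * offCornerHooks μ (x ∘ suc) (r , s)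
  offCornerHooks-∷ a μ x {suc r} {s} μ≤a _ 1≤s s≤a = begin
    Π hλ (filterᵇ p (cells (a ∷ μ)))
      ≡⟨ ≡.cong (Π hλ) (cells-∷-filter p a μ) ⟩
    Π hλ (map (1 ,_) row₁ ++ map shift rest)
      ≈⟨ Π-++ hλ (map (1 ,_) row₁) (map shift rest) ⟩
    Π hλ (map (1 ,_) row₁) * Π hλ (map shift rest)
      ≈⟨ *-cong (firstRow-hooks a μ x (filter⁺ (T? ∘ (p ∘ (1 ,_))) (All.map proj₂ (range-bounds 1 a))))
                (lowerRows-hooks a μ x μ≤a (filter⁺ (T? ∘ (p ∘ shift)) (All.map proj₁ (cells-inDiagram μ)))) ⟩
    Π H row₁ * offCornerHooks μ (x ∘ suc) (suc r , s)
      ≈⟨ *-congʳ (trans (reflexive (≡.cong (Π H) (range-omit 1≤s s≤a))) (Π-++ H (range 1 (s ∸ 1)) (range (suc s) a))) ⟩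
    Π-omit H a s * offCornerHooks μ (x ∘ suc) (suc r , s) ∎
    where
    H : ℕ → Carrier
    H = hookRow μ a (x ∘ suc) (x 1)
    hλ : ℕ × ℕ → Carrier
    hλ = hookW R x y (a ∷ μ)
    p : ℕ × ℕ → Bool
    p c = not (proj₁ c ≡ᵇ suc (suc r)) ∧ not (proj₂ c ≡ᵇ s)
    row₁ : List ℕ
    row₁ = filterᵇ (p ∘ (1 ,_)) (range 1 a)
    rest : List (ℕ × ℕ)
    rest = filterᵇ (p ∘ shift) (cells μ)

  rowsAbove-∷ : ∀ a μ x {r s} → 1 ≤ r →
    rowsAbove (a ∷ μ) x (suc r , s) ≈ cornerGap a (x ∘ suc) (r , s) * rowsAbove μ (x ∘ suc) (r , s)
  rowsAbove-∷ a μ x {suc r} {s} _ = begin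
    Π above (range 1 (suc r))
      ≡⟨ ≡.cong (Π above) (≡.trans (range-∷ {1} {suc r} (s≤s z≤n)) (≡.cong (1 ∷_) (≡.sym (map-suc-range 1 r)))) ⟩
    above 1 * Π above (map suc (range 1 r))
      ≈⟨ *-cong (+-congʳ (reflexive (rs-shift x 1 r)))
                (trans (reflexive (Π-map above suc (range 1 r)))
                       (Π-congᴬ (All.map (λ {i} (1≤i , _) → +-cong (reflexive (rs-shift x (suc i) r))
                                                                    (reflexive (≡.cong (rs y s) (part-∷ a μ 1≤i))))
                                         (range-bounds 1 r)))) ⟩
    cornerGap a (x ∘ suc) (suc r , s) * rowsAbove μ (x ∘ suc) (suc r , s) ∎
    where
    above : ℕ → Carrier
    above i = rs x (suc i) (suc r) + rs y s (part (a ∷ μ) i)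

  -- The columns left of the corner: column j of a ∷ μ minus its top cell is column j of μ.
  columnsLeft-∷ : ∀ a μ x {r s} → PartsAtMost a μ → 1 ≤ r →
    columnsLeft (a ∷ μ) x (suc r , s) ≈ columnsLeft μ (x ∘ suc) (r , s)
  columnsLeft-∷ a μ x {r} {s} μ≤a 1≤r = Π-congᴬ {xs = range 1 (s ∸ 1)} (All.tabulate (λ {j} _ → +-congʳ
    (trans (rs-shift′ x (conj (a ∷ μ) j) 1≤r) (reflexive (≡.cong (rs (x ∘ suc) r) (conj-∷-pred a μ j μ≤a))))))

  cornerTerm-lower : ∀ a μ x {r s} → PartsAtMost a μ → 1 ≤ r → 1 ≤ s → s ≤ a →
    cornerTerm R x y (a ∷ μ) (suc r , s)
      ≈ (cornerGap a (x ∘ suc) (r , s) * Π-omit (hookRow μ a (x ∘ suc) (x 1)) a s) * cornerTerm R (x ∘ suc) y μ (r , s)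
  cornerTerm-lower a μ x {r} {s} μ≤a 1≤r 1≤s s≤a = begin
    (offCornerHooks (a ∷ μ) x (suc r , s) * rowsAbove (a ∷ μ) x (suc r , s)) * columnsLeft (a ∷ μ) x (suc r , s)
      ≈⟨ *-cong (*-cong (offCornerHooks-∷ a μ x μ≤a 1≤r 1≤s s≤a) (rowsAbove-∷ a μ x {r} {s} 1≤r))
                (columnsLeft-∷ a μ x {r} {s} μ≤a 1≤r) ⟩
    (Ω * O) * (G * A) * L
      ≈⟨ solve 5 (λ Ω O G A L → ((Ω :* O) :* (G :* A)) :* L := (G :* Ω) :* ((O :* A) :* L)) refl Ω O G A L ⟩
    (G * Ω) * ((O * A) * L) ∎
    where
    Ω O G A L : Carrier
    Ω = Π-omit (hookRow μ a (x ∘ suc) (x 1)) a s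
    O = offCornerHooks μ (x ∘ suc) (r , s)
    G = cornerGap a (x ∘ suc) (r , s)
    A = rowsAbove μ (x ∘ suc) (r , s)
    L = columnsLeft μ (x ∘ suc) (r , s)

  -- The term of the corner (r + 1 , s) of a ∷ μ, written through the corner (r , s) of μ,
  -- for first x-variable z and remaining x-variables x.
  lowerCornerTerm : List ℕ → ℕ → (ℕ → Carrier) → Carrier → ℕ × ℕ → Carrier
  lowerCornerTerm μ a x z c = (cornerGap a x c * Π-omit (hookRow μ a x z) a (proj₂ c)) * cornerTerm R x y μ c

  lowerCorners-∷ : ∀ a μ x → IsPartition μ → PartsAtMost a μ →
    ∑ (cornerTerm R x y (a ∷ μ)) (map shift (cornersUpTo a μ)) ≈ ∑ (lowerCornerTerm μ a (x ∘ suc) (x 1)) (cornersUpTo a μ)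
  lowerCorners-∷ a μ x pμ μ≤a = trans (reflexive (∑-map (cornerTerm R x y (a ∷ μ)) shift (cornersUpTo a μ)))
    (∑-congᴬ (All.map (λ ((1≤r , 1≤s , _) , s≤a) → cornerTerm-lower a μ x μ≤a 1≤r 1≤s s≤a) (cornersUpTo-foot a μ pμ)))

module FirstRowIdentity {c ℓ} (R : CommutativeRing c ℓ) (y : ℕ → CommutativeRing.Carrier R) where
  open CommutativeRing R
  open BigOperators R
  open FirstRow R y
  open import Relation.Binary.Reasoning.Setoid setoid
  open import Algebra.Solver.Ring.NaturalCoefficients.Default commutativeSemiring

  -- The theorem for the partition a ∷ μ in the variables (z , x_1 , x_2 , ...), with the
  -- first row peeled off (lhs-∷, cornerTerm-first, cornerTerm-lower, outerCorners-∷).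
  -- Stated for every z, it can be proved by induction on μ.
  Peeled : List ℕ → ℕ → (ℕ → Carrier) → Carrier → Set ℓ
  Peeled μ a x z =
    Π (hookRow μ a x z) (range 1 a) * lhs R x y μ
      ≈ Π (hookRow⁺ μ a x z) (range 1 a) * lhs R x y μ + ∑ (lowerCornerTerm μ a x z) (cornersUpTo a μ)

  -- A single row a: both sides reduce to  (z + Y) E = E z + Y E  with  E = Π_{j=2}^{a} (z + y_j + ... + y_a).
  peeled-[] : ∀ a x z → Peeled [] a x z
  peeled-[] zero    x z = sym (+-identityʳ _)
  peeled-[] (suc a) x z = begin
    Π H (range 1 (suc a)) * 1#
      ≡⟨ ≡.cong (λ l → Π H l * 1#) (range-∷ {1} {suc a} (s≤s z≤n)) ⟩
    ((z + (0# + Y)) * E) * 1#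
      ≈⟨ solve 3 (λ z Y E → ((z :+ (con 0 :+ Y)) :* E) :* con 1 :=
                   (E :* z) :* con 1 :+ (((con 0 :+ Y) :* (con 1 :* E)) :* ((con 1 :* con 1) :* con 1) :+ con 0))
                 refl z Y E ⟩
    (E * z) * 1# + (((0# + Y) * (1# * E)) * ((1# * 1#) * 1#) + 0#)
      ≈⟨ +-congʳ (*-congʳ (sym shifted)) ⟩
    Π (hookRow⁺ [] (suc a) x z) (range 1 (suc a)) * 1# + ∑ (lowerCornerTerm [] (suc a) x z) (cornersUpTo (suc a) []) ∎
    where
    H : ℕ → Carrier
    H = hookRow [] (suc a) x z
    Y E : Carrier
    Y = rs y 1 (suc a)
    E = Π H (range 2 (suc a))
    -- without μ the shifted hooks are the hooks of the next column
    shifted : Π (hookRow⁺ [] (suc a) x z) (range 1 (suc a)) ≈ E * z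
    shifted = trans (Π-suc H {1} {suc a} (s≤s z≤n))
      (*-congˡ (trans (+-congˡ (trans (+-congˡ (rs-[] y {suc (suc a)} {suc a} ≤-refl)) (+-identityʳ _))) (+-identityʳ z)))

  -- The induction step: μ = b ∷ ν with b ≤ a, assuming Peeled ν b (x ∘ suc) w for all w.
  -- Its hooks split at column b; the two instances of the hypothesis used are
  -- w = u = z + x_1 + β  and  w = x_1,  where β = y_{b+1} + ... + y_a.
  module Step (b : ℕ) (ν : List ℕ) (a : ℕ) (x : ℕ → Carrier) (z : Carrier)
              (pμ : IsPartition (b ∷ ν)) (b≤a : b ≤ a) (IH : ∀ w → Peeled ν b (x ∘ suc) w) where

    μ : List ℕ
    μ = b ∷ ν
    x′ : ℕ → Carrier
    x′ = x ∘ suc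
    ν≤b : PartsAtMost b ν
    ν≤b = tail-≤-head pμ

    β u L : Carrier
    β = rs y (suc b) a
    u = z + (x 1 + β)
    L = lhs R x′ y ν

    H H⁺ P P⁺ K K⁺ : ℕ → Carrier
    H  = hookRow  μ a x z
    H⁺ = hookRow⁺ μ a x z
    P  = hookRow  ν b x′ u
    P⁺ = hookRow⁺ ν b x′ u
    K  = hookRow  ν b x′ (x 1)
    K⁺ = hookRow⁺ ν b x′ (x 1)

    F : List (ℕ × ℕ)
    F = cornersUpTo b ν
    Aν Bν Tμ : ℕ × ℕ → Carrier
    Aν = lowerCornerTerm ν b x′ (x 1)
    Bν = lowerCornerTerm ν b x′ u
    Tμ = lowerCornerTerm μ a x z

    pp pp⁺ kk kk⁺ E : Carrier
    pp  = Π P  (range 1 b)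
    pp⁺ = Π P⁺ (range 1 b)
    kk  = Π K  (range 1 b)
    kk⁺ = Π K⁺ (range 1 b)
    E   = Π H  (range (suc b) a)

    -- Columns j ≤ b: the x_1 of column j and the tail y_{b+1} + ... + y_a move into u.
    firstHook-left : ∀ {k j} → j ≤ b → k ≤ suc b → firstHook μ a x z k j ≈ firstHook ν b x′ u k j
    firstHook-left {k} {j} j≤b k≤b+1 = begin
      z + (rs x 1 (conj μ j) + rs y k a)
        ≡⟨ ≡.cong (λ n → z + (rs x 1 n + rs y k a)) (conj-∷-≤ b ν j≤b) ⟩
      z + (rs x 1 (suc (conj ν j)) + rs y k a)
        ≈⟨ +-congˡ (+-cong (rs-1+ x (conj ν j)) (rs-++ y k≤b+1 b≤a)) ⟩
      z + ((x 1 + X) + (Y + β))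
        ≈⟨ solve 5 (λ z x₁ X Y β → z :+ ((x₁ :+ X) :+ (Y :+ β)) := (z :+ (x₁ :+ β)) :+ (X :+ Y)) refl z (x 1) X Y β ⟩
      u + (X + Y) ∎
      where
      X Y : Carrier
      X = rs x′ 1 (conj ν j)
      Y = rs y k b

    -- Columns j > b of the first row meet no cell of μ below.
    firstHook-right : ∀ {k j} → b < j → firstHook μ a x z k j ≈ z + rs y k a
    firstHook-right {k} {j} b<j
      rewrite conj-beyond μ {j} (b<j ∷ All.map (λ i≤b → ≤-trans (s≤s i≤b) b<j) ν≤b) = +-congˡ (+-identityˡ _)

    hook-left : ∀ {j} → j ≤ b → H j ≈ P j
    hook-left j≤b = firstHook-left j≤b (≤-trans j≤b (n≤1+n b))

    split-at-b : ∀ (f g : ℕ → Carrier) → (∀ {j} → j ≤ b → f j ≈ g j) →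
      Π f (range 1 a) ≈ Π g (range 1 b) * Π f (range (suc b) a)
    split-at-b f g f≈g = trans (reflexive (≡.cong (Π f) (range-++ {1} {b} {a} (s≤s z≤n) b≤a)))
      (trans (Π-++ f (range 1 b) (range (suc b) a)) (*-congʳ (Π-congᴬ (All.map (λ (_ , j≤b) → f≈g j≤b) (range-bounds 1 b)))))

    hooks-split : Π H (range 1 a) ≈ pp * E
    hooks-split = split-at-b H P hook-left

    hooks⁺-split : Π H⁺ (range 1 a) ≈ pp⁺ * Π H⁺ (range (suc b) a)
    hooks⁺-split = split-at-b H⁺ P⁺ (λ j≤b → firstHook-left j≤b (s≤s j≤b))

    omit-split : ∀ {s} → 1 ≤ s → s ≤ b → Π-omit H a s ≈ Π-omit P b s * E
    omit-split {s} 1≤s s≤b = begin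
      Π H (range 1 (s ∸ 1)) * Π H (range (suc s) a)
        ≡⟨ ≡.cong (λ l → Π H (range 1 (s ∸ 1)) * Π H l) (range-++ {suc s} {b} {a} (s≤s s≤b) b≤a) ⟩
      Π H (range 1 (s ∸ 1)) * Π H (range (suc s) b ++ range (suc b) a)
        ≈⟨ *-congˡ (Π-++ H (range (suc s) b) (range (suc b) a)) ⟩
      Π H (range 1 (s ∸ 1)) * (Π H (range (suc s) b) * E)
        ≈⟨ *-cong (Π-congᴬ (All.map (λ (_ , j≤s-1) → hook-left (≤-trans j≤s-1 (≤-trans (m∸n≤m s 1) s≤b)))
                                    (range-bounds 1 (s ∸ 1))))
                  (*-congʳ (Π-congᴬ (All.map (λ (_ , j≤b) → hook-left j≤b) (range-bounds (suc s) b)))) ⟩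
      Π P (range 1 (s ∸ 1)) * (Π P (range (suc s) b) * E)
        ≈⟨ sym (*-assoc _ _ _) ⟩
      Π-omit P b s * E ∎

    lhs-μ : lhs R x y μ ≈ kk * L
    lhs-μ = lhs-∷ b ν x ν≤b

    F-corners : All (λ c → CornerFoot ν c × proj₂ c ≤ b) F
    F-corners = cornersUpTo-foot b ν (tail-partition pμ)

    -- The corners of μ are (1 , b + 1) and the corners F of ν moved down; the latter all
    -- lie in columns ≤ b ≤ a and so are kept in cornersUpTo a μ.
    corners-μ : outerCorners μ ≡ (1 , suc b) ∷ map shift F
    corners-μ = outerCorners-∷ b ν (head-positive pμ) ν≤b (tail-partition pμ)

    shifted-kept : filterᵇ (λ c → proj₂ c ≤ᵇ a) (map shift F) ≡ map shift F
    shifted-kept =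
      filter-all (T? ∘ (λ c → proj₂ c ≤ᵇ a)) (map⁺ (All.map (λ (_ , s≤b) → ≤⇒≤ᵇ (≤-trans s≤b b≤a)) F-corners))

    -- Pulling the factor of column s out of pp and kk; at a corner (r , s) of ν the
    -- column s has r − 1 cells, so that factor is u + g resp. x_1 + g with g its gap.
    extract : ∀ w {r s} → CornerFoot ν (r , s) → s ≤ b →
      Π (hookRow ν b x′ w) (range 1 b) ≈ (w + cornerGap b x′ (r , s)) * Π-omit (hookRow ν b x′ w) b s
    extract w {r} {s} (_ , 1≤s , foot) s≤b =
      trans (Π-extract (hookRow ν b x′ w) 1≤s s≤b) (*-congʳ (reflexive (≡.cong (λ n → w + (rs x′ 1 n + rs y s b)) foot)))

    lowerCorner : ∀ {r s} → CornerFoot ν (r , s) → s ≤ b →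
      Tμ (suc r , s) ≈ (((x 1 + rs x′ 1 (r ∸ 1)) + (rs y s b + β)) * (Π-omit P b s * E)) * Aν (r , s)
    lowerCorner {suc r} {s} (1≤r , 1≤s , _) s≤b =
      *-cong (*-cong (+-cong (rs-1+ x r) (rs-++ y (≤-trans s≤b (n≤1+n b)) b≤a)) (omit-split 1≤s s≤b))
             (cornerTerm-lower b ν x ν≤b 1≤r 1≤s s≤b)

    ΣA ΣB : Carrier
    ΣA = ∑ Aν F
    ΣB = ∑ Bν F

    -- b < a: the first row of μ is strictly shorter, and (1 , b + 1) is a corner of μ in a column ≤ a.
    module Short (b<a : suc b ≤ a) where

      e : Carrier
      e = Π H (range (suc (suc b)) a)

      E-split : E ≈ (z + β) * e
      E-split = trans (reflexive (≡.cong (Π H) (range-∷ b<a))) (*-congʳ (firstHook-right {suc b} ≤-refl))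

      -- beyond column b the shifted hooks are the hooks of the next column, ending with z
      E⁺-split : Π H⁺ (range (suc b) a) ≈ e * z
      E⁺-split = begin
        Π H⁺ (range (suc b) a)
          ≈⟨ Π-congᴬ (All.map (λ (b<j , _) → next-column b<j) (range-bounds (suc b) a)) ⟩
        Π (H ∘ suc) (range (suc b) a)
          ≈⟨ Π-suc H b<a ⟩
        e * H (suc a)
          ≈⟨ *-congˡ (trans (firstHook-right {suc a} (s≤s b≤a)) (trans (+-congˡ (rs-[] y {suc a} {a} ≤-refl)) (+-identityʳ z))) ⟩
        e * z ∎
        where
        next-column : ∀ {j} → b < j → H⁺ j ≈ H (suc j)
        next-column {j} b<j = trans (firstHook-right {suc j} b<j) (sym (firstHook-right {suc j} (≤-trans b<j (n≤1+n j))))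

      corners : cornersUpTo a μ ≡ (1 , suc b) ∷ map shift F
      corners = ≡.trans (≡.cong (filterᵇ (λ c → proj₂ c ≤ᵇ a)) corners-μ)
                        (≡.trans (filter-accept (T? ∘ (λ c → proj₂ c ≤ᵇ a)) (≤⇒≤ᵇ b<a)) (≡.cong ((1 , suc b) ∷_) shifted-kept))

      topCorner : Tμ (1 , suc b) ≈ ((0# + β) * (pp * e)) * (kk⁺ * L)
      topCorner = *-cong (*-congˡ (*-congʳ (Π-congᴬ (All.map (λ (_ , j≤b) → hook-left j≤b) (range-bounds 1 b)))))
                         (cornerTerm-first b ν x ν≤b)

      lowerCorners : ∑ Tμ (map shift F) ≈ e * (β * (pp * ΣA) + z * (kk * ΣB))
      lowerCorners = begin
        ∑ Tμ (map shift F)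
          ≡⟨ ∑-map Tμ shift F ⟩
        ∑ (Tμ ∘ shift) F
          ≈⟨ ∑-congᴬ (All.map (λ {c} (foot , s≤b) → corner c foot s≤b) F-corners) ⟩
        ∑ (λ c → e * (β * (pp * Aν c) + z * (kk * Bν c))) F
          ≈⟨ ∑-*ˡ e _ F ⟩
        e * ∑ (λ c → β * (pp * Aν c) + z * (kk * Bν c)) F
          ≈⟨ *-congˡ (trans (∑-+ _ _ F) (+-cong (∑-*ˡ² β pp Aν) (∑-*ˡ² z kk Bν))) ⟩
        e * (β * (pp * ΣA) + z * (kk * ΣB)) ∎
        where
        ∑-*ˡ² : ∀ k₁ k₂ f → ∑ (λ c → k₁ * (k₂ * f c)) F ≈ k₁ * (k₂ * ∑ f F)
        ∑-*ˡ² k₁ k₂ f = trans (∑-*ˡ k₁ (λ c → k₂ * f c) F) (*-congˡ (∑-*ˡ k₂ f F))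
        corner : ∀ c → CornerFoot ν c → proj₂ c ≤ b → Tμ (shift c) ≈ e * (β * (pp * Aν c) + z * (kk * Bν c))
        corner (r , s) foot s≤b = begin
          Tμ (suc r , s)
            ≈⟨ trans (lowerCorner foot s≤b) (*-congʳ (*-congˡ (*-congˡ E-split))) ⟩
          (((x 1 + X) + (Y + β)) * (Ωᴾ * ((z + β) * e))) * ((g * Ωᴷ) * C)
            ≈⟨ solve 9 (λ x₁ X Y β z e Ωᴾ Ωᴷ C →
                 (((x₁ :+ X) :+ (Y :+ β)) :* (Ωᴾ :* ((z :+ β) :* e))) :* (((X :+ Y) :* Ωᴷ) :* C) :=
                 e :* (β :* ((((z :+ (x₁ :+ β)) :+ (X :+ Y)) :* Ωᴾ) :* (((X :+ Y) :* Ωᴷ) :* C)) :+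
                       z :* (((x₁ :+ (X :+ Y)) :* Ωᴷ) :* (((X :+ Y) :* Ωᴾ) :* C))))
               refl (x 1) X Y β z e Ωᴾ Ωᴷ C ⟩
          e * (β * (((u + g) * Ωᴾ) * Aν (r , s)) + z * (((x 1 + g) * Ωᴷ) * Bν (r , s)))
            ≈⟨ *-congˡ (+-cong (*-congˡ (*-congʳ (sym (extract u foot s≤b)))) (*-congˡ (*-congʳ (sym (extract (x 1) foot s≤b))))) ⟩
          e * (β * (pp * Aν (r , s)) + z * (kk * Bν (r , s))) ∎
          where
          X Y g Ωᴾ Ωᴷ C : Carrier
          X = rs x′ 1 (r ∸ 1)
          Y = rs y s b
          g = cornerGap b x′ (r , s)
          Ωᴾ = Π-omit P b s
          Ωᴷ = Π-omit K b s
          C = cornerTerm R x′ y ν (r , s)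

      -- Expand E, apply the hypothesis at u (to pp L) and at x_1 (to kk L), and regroup.
      peeled : Peeled μ a x z
      peeled = begin
        Π H (range 1 a) * lhs R x y μ
          ≈⟨ *-cong (trans hooks-split (*-congˡ E-split)) lhs-μ ⟩
        (pp * ((z + β) * e)) * (kk * L)
          ≈⟨ solve 6 (λ pp z β e kk L → (pp :* ((z :+ β) :* e)) :* (kk :* L) := e :* (z :* (kk :* (pp :* L)) :+ β :* (pp :* (kk :* L))))
               refl pp z β e kk L ⟩
        e * (z * (kk * (pp * L)) + β * (pp * (kk * L)))
          ≈⟨ *-congˡ (+-cong (*-congˡ (*-congˡ (IH u))) (*-congˡ (*-congˡ (IH (x 1))))) ⟩
        e * (z * (kk * (pp⁺ * L + ΣB)) + β * (pp * (kk⁺ * L + ΣA)))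
          ≈⟨ solve 10 (λ pp pp⁺ kk kk⁺ z β e L ΣA ΣB →
                 e :* (z :* (kk :* (pp⁺ :* L :+ ΣB)) :+ β :* (pp :* (kk⁺ :* L :+ ΣA))) :=
                 (pp⁺ :* (e :* z)) :* (kk :* L) :+ (((con 0 :+ β) :* (pp :* e)) :* (kk⁺ :* L) :+ e :* (β :* (pp :* ΣA) :+ z :* (kk :* ΣB))))
               refl pp pp⁺ kk kk⁺ z β e L ΣA ΣB ⟩
        (pp⁺ * (e * z)) * (kk * L) + (((0# + β) * (pp * e)) * (kk⁺ * L) + e * (β * (pp * ΣA) + z * (kk * ΣB)))
          ≈⟨ sym (+-cong (*-cong (trans hooks⁺-split (*-congˡ E⁺-split)) lhs-μ) (+-cong topCorner lowerCorners)) ⟩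
        Π H⁺ (range 1 a) * lhs R x y μ + ∑ Tμ ((1 , suc b) ∷ map shift F)
          ≡⟨ ≡.cong (λ cs → Π H⁺ (range 1 a) * lhs R x y μ + ∑ Tμ cs) (≡.sym corners) ⟩
        Π H⁺ (range 1 a) * lhs R x y μ + ∑ Tμ (cornersUpTo a μ) ∎

    -- b = a: the first two rows have equal length, so β = 0, the column-(b+1) corner is
    -- not kept, and only the hypothesis at u is needed.
    module Flush (a<b+1 : a < suc b) where

      β≈0 : β ≈ 0#
      β≈0 = rs-[] y a<b+1

      E≈1 : E ≈ 1#
      E≈1 = reflexive (≡.cong (Π H) (range-[] a<b+1))

      E⁺≈1 : Π H⁺ (range (suc b) a) ≈ 1#
      E⁺≈1 = reflexive (≡.cong (Π H⁺) (range-[] a<b+1))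

      corners : cornersUpTo a μ ≡ map shift F
      corners = ≡.trans (≡.cong (filterᵇ (λ c → proj₂ c ≤ᵇ a)) corners-μ)
                        (≡.trans (filter-reject (T? ∘ (λ c → proj₂ c ≤ᵇ a)) (¬T-≤ᵇ a<b+1)) shifted-kept)

      lowerCorners : ∑ Tμ (map shift F) ≈ kk * ΣB
      lowerCorners = trans (reflexive (∑-map Tμ shift F))
        (trans (∑-congᴬ (All.map (λ {c} (foot , s≤b) → corner c foot s≤b) F-corners)) (∑-*ˡ kk Bν F))
        where
        corner : ∀ c → CornerFoot ν c → proj₂ c ≤ b → Tμ (shift c) ≈ kk * Bν c
        corner (r , s) foot s≤b = begin
          Tμ (suc r , s)
            ≈⟨ trans (lowerCorner foot s≤b) (*-congʳ (*-cong (+-congˡ (+-congˡ β≈0)) (*-congˡ E≈1))) ⟩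
          (((x 1 + X) + (Y + 0#)) * (Ωᴾ * 1#)) * (((X + Y) * Ωᴷ) * C)
            ≈⟨ solve 6 (λ x₁ X Y Ωᴾ Ωᴷ C →
                 (((x₁ :+ X) :+ (Y :+ con 0)) :* (Ωᴾ :* con 1)) :* (((X :+ Y) :* Ωᴷ) :* C) :=
                 ((x₁ :+ (X :+ Y)) :* Ωᴷ) :* (((X :+ Y) :* Ωᴾ) :* C))
               refl (x 1) X Y Ωᴾ Ωᴷ C ⟩
          ((x 1 + cornerGap b x′ (r , s)) * Ωᴷ) * Bν (r , s)
            ≈⟨ *-congʳ (sym (extract (x 1) foot s≤b)) ⟩
          kk * Bν (r , s) ∎
          where
          X Y Ωᴾ Ωᴷ C : Carrier
          X = rs x′ 1 (r ∸ 1)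
          Y = rs y s b
          Ωᴾ = Π-omit P b s
          Ωᴷ = Π-omit K b s
          C = cornerTerm R x′ y ν (r , s)

      peeled : Peeled μ a x z
      peeled = begin
        Π H (range 1 a) * lhs R x y μ
          ≈⟨ *-cong (trans hooks-split (*-congˡ E≈1)) lhs-μ ⟩
        (pp * 1#) * (kk * L)
          ≈⟨ solve 3 (λ pp kk L → (pp :* con 1) :* (kk :* L) := kk :* (pp :* L)) refl pp kk L ⟩
        kk * (pp * L)
          ≈⟨ *-congˡ (IH u) ⟩
        kk * (pp⁺ * L + ΣB)
          ≈⟨ solve 4 (λ pp⁺ kk L ΣB → kk :* (pp⁺ :* L :+ ΣB) := (pp⁺ :* con 1) :* (kk :* L) :+ kk :* ΣB) refl pp⁺ kk L ΣB ⟩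
        (pp⁺ * 1#) * (kk * L) + kk * ΣB
          ≈⟨ sym (+-cong (*-cong (trans hooks⁺-split (*-congˡ E⁺≈1)) lhs-μ) lowerCorners) ⟩
        Π H⁺ (range 1 a) * lhs R x y μ + ∑ Tμ (map shift F)
          ≡⟨ ≡.cong (λ cs → Π H⁺ (range 1 a) * lhs R x y μ + ∑ Tμ cs) (≡.sym corners) ⟩
        Π H⁺ (range 1 a) * lhs R x y μ + ∑ Tμ (cornersUpTo a μ) ∎

    step : Peeled μ a x z
    step with suc b ≤? a
    ... | yes b<a = Short.peeled b<a
    ... | no  b≮a = Flush.peeled (≰⇒> b≮a)

  peeled : ∀ μ → IsPartition μ → ∀ a → PartsAtMost a μ → ∀ x z → Peeled μ a x z
  peeled []      _ a _          x z = peeled-[] a x z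
  peeled (b ∷ ν) p a (b≤a ∷ _) x z = Step.step b ν a x z p b≤a (peeled ν (tail-partition p) b (tail-≤-head p) (x ∘ suc))

theorem1 : ∀ {c ℓ} (R : CommutativeRing c ℓ) (lam : List ℕ) → IsPartition lam →
    (x y : ℕ → CommutativeRing.Carrier R) →
    CommutativeRing._≈_ R (lhs R x y lam) (rhs R x y lam)
theorem1 R []      _ x y = sym (trans (+-identityʳ _) (trans (*-identityʳ _) (*-identityʳ _)))
  where open CommutativeRing R
theorem1 R (a ∷ μ) p x y = begin
  lhs R x y (a ∷ μ)
    ≈⟨ lhs-∷ a μ x μ≤a ⟩
  Π (hookRow μ a x′ (x 1)) (range 1 a) * lhs R x′ y μ
    ≈⟨ peeled μ pμ a μ≤a x′ (x 1) ⟩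
  Π (hookRow⁺ μ a x′ (x 1)) (range 1 a) * lhs R x′ y μ + ∑ (lowerCornerTerm μ a x′ (x 1)) (cornersUpTo a μ)
    ≈⟨ sym (+-cong (cornerTerm-first a μ x μ≤a) (lowerCorners-∷ a μ x pμ μ≤a)) ⟩
  ∑ (cornerTerm R x y (a ∷ μ)) ((1 , suc a) ∷ map shift (cornersUpTo a μ))
    ≡⟨ ≡.cong (∑ (cornerTerm R x y (a ∷ μ))) (≡.sym (outerCorners-∷ a μ (head-positive p) μ≤a pμ)) ⟩
  rhs R x y (a ∷ μ) ∎
  where
  open CommutativeRing R
  open BigOperators R
  open FirstRow R y
  open FirstRowIdentity R y
  open import Relation.Binary.Reasoning.Setoid setoid
  x′ : ℕ → Carrier
  x′ = x ∘ suc
  pμ : IsPartition μ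
  pμ = tail-partition p
  μ≤a : PartsAtMost a μ
  μ≤a = tail-≤-head p
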